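{- For $r\ge0$ let $v_r(n)$ be the number of permutations of $[n]$ containing exactly $r$ occurrences of the pattern $23\text{ - }1$, and $V_r(x)=\sum_{n\ge0}v_r(n)x^n$. Then, as formal power series, $$V_1(x)=\frac{x}{1-x}V_1\Bigl(\frac{x}{1-x}\Bigr)+x\left(V_0\Bigl(\frac{x}{1-x}\Bigr)-V_0(x)\right).$$
   Context: An occurrence of the pattern $23\text{ - }1$ in a permutation $a_1a_2\cdots a_n$ is a pair of indices $(i,j)$ with $i+1<j\le n$ such that $a_j<a_i<a_{i+1}$. The empty permutation has no occurrences, so $v_0(0)=1$. -}

module Defs where

open import Data.Nat as ℕ using (ℕ; zero; suc; _∸_)
open import Data.Integer as ℤ using (ℤ; +_)
open import Data.Fin as Fin using (Fin; toℕ)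
open import Data.List using (List; []; _∷_; length; filter; map; concatMap; allFin)
import Data.List.Relation.Unary.Unique.DecPropositional as UDec
open import Relation.Nullary.Decidable using (does)
open import Data.Bool using (if_then_else_)

-- Permutations of [n] as words a₁…aₙ (values in Fin n, i.e. 0..n-1)

words : (n k : ℕ) → List (List (Fin n))
words n zero    = [] ∷ []
words n (suc k) = concatMap (λ w → map (_∷ w) (allFin n)) (words n k)

perms : (n : ℕ) → List (List (Fin n))
perms n = filter (UDec.unique? (Fin._≟_ {n})) (words n n)

countBelow : ∀ {n} → Fin n → List (Fin n) → ℕ
countBelow x []       = 0
countBelow x (z ∷ zs) = (if does (z Fin.<? x) then 1 else 0) ℕ.+ countBelow x zs

-- number of occurrences of 23-1: pairs (i,j), i+1<j, a_j < a_i < a_{i+1}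
occ231 : ∀ {n} → List (Fin n) → ℕ
occ231 []            = 0
occ231 (x ∷ [])      = 0
occ231 (x ∷ y ∷ rest) =
  (if does (x Fin.<? y) then countBelow x rest else 0) ℕ.+ occ231 (y ∷ rest)

v : ℕ → ℕ → ℕ
v r n = length (filter (λ p → occ231 p ℕ.≟ r) (perms n))

Series : Set
Series = ℕ → ℤ

V : ℕ → Series
V r n = + v r n

sumTo : (ℕ → ℤ) → ℕ → ℤ
sumTo f zero    = f zero
sumTo f (suc n) = sumTo f n ℤ.+ f (suc n)

_⊕_ : Series → Series → Series
(f ⊕ g) n = f n ℤ.+ g n

_⊖_ : Series → Series → Series
(f ⊖ g) n = f n ℤ.- g n

_⊛_ : Series → Series → Series
(f ⊛ g) n = sumTo (λ k → f k ℤ.* g (n ∸ k)) n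

one : Series
one zero    = + 1
one (suc _) = + 0

X : Series
X (suc zero) = + 1
X _          = + 0

pow : Series → ℕ → Series
pow h zero    = one
pow h (suc m) = h ⊛ pow h m

-- composition g(h(x)), for h with zero constant term (then hᵐ has order ≥ m,
-- so only m ≤ n contribute to the coefficient of xⁿ)
_∘ₛ_ : Series → Series → Series
(g ∘ₛ h) n = sumTo (λ m → g m ℤ.* pow h m n) n

xOver1-x : Series
xOver1-x zero    = + 0
xOver1-x (suc _) = + 1

{-# OPTIONS --safe #-}

-- Every permutation of [n+1] is a ◃ q: its first letter a followed by a permutation q of [n]
-- relabelled by punchIn a, which does not change the number of occurrences of 23-1. In a ◃ b ◃ q
-- the first two letters form an ascent iff a ≤ b, and then they are the 23 of exactly a occurrences,
-- because every letter below a comes later. Hence the numbers of permutations with first letter a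
-- and with 0, resp. 1, occurrences satisfy prefix-sum recurrences in a, i.e. Pascal's rule, and
-- iterating Pascal's rule gives binomial transforms:
--   v₀(m+1) = Σᵢ C(m,i) v₀(i),   v₁(m+2) + v₀(m+1) = Σᵢ C(m+1,i) v₁(i) + Σᵢ C(m,i) v₀(i+1).
-- Composition with x/(1-x) acts on coefficients as the binomial transform, so these are the
-- coefficients of the functional equation.
module Submission where

open import Defs
open import Data.Nat using (ℕ)
open import Relation.Binary.PropositionalEquality using (_≡_)

open import Data.Bool using (Bool; true; false; if_then_else_)
open import Data.Fin as Fin using (Fin; zero; suc; toℕ; punchIn; punchOut)
import Data.Fin.Properties as Fin
open import Data.Integer as ℤ using (ℤ; +_)
import Data.Integer.Properties as ℤ
open import Data.Integer.Tactic.RingSolver using (solve-∀)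
open import Data.Nat.Tactic.RingSolver using () renaming (solve-∀ to ℕ-solve-∀)
open import Data.List using (List; []; _∷_; length; filter; map; concatMap; allFin; tabulate; _++_)
open import Data.List.Properties using (length-map; map-++; map-∘; map-cong; map-tabulate; map-injective; ∷-injective)
open import Data.List.Membership.Propositional using (_∈_; find; lose)
open import Data.List.Membership.Propositional.Properties
  using (∈-map⁺; ∈-map⁻; ∈-concatMap⁺; ∈-concatMap⁻; ∈-allFin; ∈-filter⁺; ∈-filter⁻)
open import Data.List.Membership.Propositional.Properties.WithK using (unique∧set⇒bag)
open import Data.List.Relation.Binary.Disjoint.Propositional using (Disjoint)
open import Data.List.Relation.Binary.BagAndSetEquality using (_∼[_]_; set; ∼bag⇒↭)
open import Data.List.Relation.Binary.Permutation.Propositional using (_↭_)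
open import Data.List.Relation.Binary.Permutation.Propositional.Properties using (↭-length; filter-↭)
import Data.List.Relation.Binary.Permutation.Propositional.Properties as ↭
open import Data.List.Relation.Unary.All using (All; []; _∷_)
import Data.List.Relation.Unary.All as All
import Data.List.Relation.Unary.All.Properties as All
open import Data.List.Relation.Unary.AllPairs using ([]; _∷_)
open import Data.List.Relation.Unary.Any using (here; there)
open import Data.List.Relation.Unary.Unique.Propositional using (Unique)
import Data.List.Relation.Unary.Unique.Propositional.Properties as Unique
import Data.List.Relation.Unary.Unique.DecPropositional as UniqueDec
open import Data.Nat as ℕ using (zero; suc; _+_; _*_; _∸_; _≤_; _≤ᵇ_; _≡ᵇ_; z≤n; s≤s)
open import Data.Nat.Combinatorics using (_C_; nCk+nC[k+1]≡[n+1]C[k+1]; k>n⇒nCk≡0)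
open import Data.Nat.ListAction using (sum)
open import Data.Nat.ListAction.Properties using (sum-++; sum-↭)
import Data.Nat.Properties as ℕ
open import Algebra.Properties.CommutativeSemigroup ℕ.+-commutativeSemigroup using (interchange)
open import Data.Product using (∃₂; _×_; _,_; proj₁; proj₂)
open import Function using (_∘_; _⇔_; mk⇔; Equivalence)
open import Relation.Binary.PropositionalEquality using (refl; sym; trans; cong; cong₂; subst; _≢_; module ≡-Reasoning)
open import Relation.Nullary using (Dec; does; yes; no)
open import Relation.Nullary.Decidable using (does-⇔; dec-false)
open import Relation.Nullary.Reflects using (ofʸ)

private variable
  A B E : Set
  m n : ℕ

indicator : (A → Bool) → A → ℕ
indicator p x = if p x then 1 else 0

countᵇ : (A → Bool) → List A → ℕ
countᵇ p = sum ∘ map (indicator p)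

countᵇ-++ : (p : A → Bool) (xs ys : List A) → countᵇ p (xs ++ ys) ≡ countᵇ p xs + countᵇ p ys
countᵇ-++ p xs ys = trans (cong sum (map-++ (indicator p) xs ys)) (sum-++ (map (indicator p) xs) _)

countᵇ-map : (p : B → Bool) (f : A → B) (xs : List A) → countᵇ p (map f xs) ≡ countᵇ (p ∘ f) xs
countᵇ-map p f xs = cong sum (sym (map-∘ xs))

countᵇ-concatMap : (p : B → Bool) (f : A → List B) (xs : List A) →
                   countᵇ p (concatMap f xs) ≡ sum (map (countᵇ p ∘ f) xs)
countᵇ-concatMap p f []       = refl
countᵇ-concatMap p f (x ∷ xs) = trans (countᵇ-++ p (f x) _) (cong (_+_ (countᵇ p (f x))) (countᵇ-concatMap p f xs))

countᵇ-cong : {p q : A → Bool} (xs : List A) → (∀ {x} → x ∈ xs → p x ≡ q x) → countᵇ p xs ≡ countᵇ q xs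
countᵇ-cong []       eq = refl
countᵇ-cong (x ∷ xs) eq = cong₂ (λ b k → (if b then 1 else 0) + k) (eq (here refl)) (countᵇ-cong xs (eq ∘ there))

countᵇ-↭ : (p : A → Bool) {xs ys : List A} → xs ↭ ys → countᵇ p xs ≡ countᵇ p ys
countᵇ-↭ p = sum-↭ ∘ ↭.map⁺ _

countᵇ-false : (xs : List A) → countᵇ (λ _ → false) xs ≡ 0
countᵇ-false []       = refl
countᵇ-false (x ∷ xs) = countᵇ-false xs

length-filter : {P : A → Set} (P? : ∀ x → Dec (P x)) (xs : List A) →
                length (filter P? xs) ≡ countᵇ (does ∘ P?) xs
length-filter P? []       = refl
length-filter P? (x ∷ xs) with does (P? x)
... | true  = cong suc (length-filter P? xs)
... | false = length-filter P? xs

∈-concatMap-map⁺ : (g : A → B → E) {xs : List A} {ys : List B} {a : A} {b : B} →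
                   a ∈ xs → b ∈ ys → g a b ∈ concatMap (λ a → map (g a) ys) xs
∈-concatMap-map⁺ g {ys = ys} a∈xs b∈ys = ∈-concatMap⁺ (λ a → map (g a) ys) (lose a∈xs (∈-map⁺ (g _) b∈ys))

∈-concatMap-map⁻ : (g : A → B → E) {xs : List A} {ys : List B} {c : E} →
                   c ∈ concatMap (λ a → map (g a) ys) xs → ∃₂ λ a b → a ∈ xs × b ∈ ys × c ≡ g a b
∈-concatMap-map⁻ g {xs} {ys} c∈ with find (∈-concatMap⁻ (λ a → map (g a) ys) {xs = xs} c∈)
... | a , a∈xs , c∈map with ∈-map⁻ (g a) c∈map
... | b , b∈ys , c≡gab = a , b , a∈xs , b∈ys , c≡gab

concatMap-map-unique : (g : A → B → E) → (∀ {a a′ b b′} → g a b ≡ g a′ b′ → a ≡ a′ × b ≡ b′) →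
                       {xs : List A} {ys : List B} → Unique xs → Unique ys →
                       Unique (concatMap (λ a → map (g a) ys) xs)
concatMap-map-unique g inj []            ys! = []
concatMap-map-unique g inj {a ∷ xs} {ys} (a∉xs ∷ xs!) ys! =
  Unique.++⁺ (Unique.map⁺ (proj₂ ∘ inj) ys!) (concatMap-map-unique g inj xs! ys!) disjoint
  where
  disjoint : Disjoint (map (g a) ys) (concatMap (λ a → map (g a) ys) xs)
  disjoint (c∈₁ , c∈₂) with ∈-map⁻ (g a) c∈₁ | ∈-concatMap-map⁻ g c∈₂
  ... | _ , _ , refl | _ , _ , a′∈xs , _ , eq = All.lookup a∉xs a′∈xs (proj₁ (inj eq))

∈-words⁻ : ∀ n k {w} → w ∈ words n k → length w ≡ k
∈-words⁻ n zero    (here refl) = refl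
∈-words⁻ n (suc k) w∈ with ∈-concatMap-map⁻ (λ w a → a ∷ w) {xs = words n k} w∈
... | w , a , w∈ , _ , refl = cong suc (∈-words⁻ n k w∈)

∈-words⁺ : ∀ n (w : List (Fin n)) → w ∈ words n (length w)
∈-words⁺ n []      = here refl
∈-words⁺ n (a ∷ w) = ∈-concatMap-map⁺ (λ w a → a ∷ w) (∈-words⁺ n w) (∈-allFin a)

words-unique : ∀ n k → Unique (words n k)
words-unique n zero    = [] ∷ []
words-unique n (suc k) =
  concatMap-map-unique (λ w a → a ∷ w) (λ eq → let a≡a′ , w≡w′ = ∷-injective eq in w≡w′ , a≡a′)
    (words-unique n k) (Unique.allFin⁺ n)

_◃_ : Fin (suc n) → List (Fin n) → List (Fin (suc n))
a ◃ q = a ∷ map (punchIn a) q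

infixr 5 _◃_

permsByFirst : (n : ℕ) → List (List (Fin n))
permsByFirst zero    = [] ∷ []
permsByFirst (suc n) = concatMap (λ a → map (a ◃_) (permsByFirst n)) (allFin (suc n))

◃-injective : {a a′ : Fin (suc n)} {q q′ : List (Fin n)} → a ◃ q ≡ a′ ◃ q′ → a ≡ a′ × q ≡ q′
◃-injective {a = a} eq with ∷-injective eq
... | refl , tail≡ = refl , map-injective (Fin.punchIn-injective a _ _) tail≡

permsByFirst-unique : ∀ n → Unique (permsByFirst n)
permsByFirst-unique zero    = [] ∷ []
permsByFirst-unique (suc n) = concatMap-map-unique _◃_ ◃-injective (Unique.allFin⁺ (suc n)) (permsByFirst-unique n)

◃-∈-permsByFirst : {q : List (Fin n)} (a : Fin (suc n)) → q ∈ permsByFirst n → a ◃ q ∈ permsByFirst (suc n)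
◃-∈-permsByFirst a q∈ = ∈-concatMap-map⁺ _◃_ (∈-allFin a) q∈

∈-permsByFirst-inv : ∀ n {p} → p ∈ permsByFirst (suc n) → ∃₂ λ a q → q ∈ permsByFirst n × p ≡ a ◃ q
∈-permsByFirst-inv n p∈ with ∈-concatMap-map⁻ _◃_ {xs = allFin (suc n)} p∈
... | a , q , _ , q∈ , p≡ = a , q , q∈ , p≡

permsByFirst-length : ∀ n {p} → p ∈ permsByFirst n → length p ≡ n
permsByFirst-length zero    (here refl) = refl
permsByFirst-length (suc n) p∈ with ∈-permsByFirst-inv n p∈
... | a , q , q∈ , refl = cong suc (trans (length-map (punchIn a) q) (permsByFirst-length n q∈))

permsByFirst-distinct : ∀ n {p} → p ∈ permsByFirst n → Unique p
permsByFirst-distinct zero    (here refl) = []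
permsByFirst-distinct (suc n) p∈ with ∈-permsByFirst-inv n p∈
... | a , q , q∈ , refl =
  All.map⁺ (All.tabulate (λ {x} _ → Fin.punchInᵢ≢i a x ∘ sym))
  ∷ Unique.map⁺ (Fin.punchIn-injective a _ _) (permsByFirst-distinct n q∈)

permsByFirst-complete : ∀ n {p} → p ∈ permsByFirst n → (x : Fin n) → x ∈ p
permsByFirst-complete (suc n) p∈ x with ∈-permsByFirst-inv n p∈
... | a , q , q∈ , refl with a Fin.≟ x
...   | yes refl = here refl
...   | no a≢x   = there (subst (_∈ map (punchIn a) q) (Fin.punchIn-punchOut a≢x)
                                (∈-map⁺ (punchIn a) (permsByFirst-complete n q∈ (punchOut a≢x))))

punchOutAll : (a : Fin (suc n)) (xs : List (Fin (suc n))) → All (a ≢_) xs → List (Fin n)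
punchOutAll a []       []           = []
punchOutAll a (x ∷ xs) (a≢x ∷ a≢xs) = punchOut a≢x ∷ punchOutAll a xs a≢xs

map-punchIn-punchOutAll : (a : Fin (suc n)) (xs : List (Fin (suc n))) (a≢xs : All (a ≢_) xs) →
                          map (punchIn a) (punchOutAll a xs a≢xs) ≡ xs
map-punchIn-punchOutAll a []       []           = refl
map-punchIn-punchOutAll a (x ∷ xs) (a≢x ∷ a≢xs) =
  cong₂ _∷_ (Fin.punchIn-punchOut a≢x) (map-punchIn-punchOutAll a xs a≢xs)

∈-permsByFirst⁺ : ∀ n (p : List (Fin n)) → length p ≡ n → Unique p → p ∈ permsByFirst n
∈-permsByFirst⁺ zero    []       _   _             = here refl
∈-permsByFirst⁺ (suc n) (a ∷ xs) len (a≢xs ∷ xs!) =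
  subst (λ ys → a ∷ ys ∈ permsByFirst (suc n)) map-q≡xs
        (◃-∈-permsByFirst a (∈-permsByFirst⁺ n q q-length (Unique.map⁻ (subst Unique (sym map-q≡xs) xs!))))
  where
  q = punchOutAll a xs a≢xs
  map-q≡xs = map-punchIn-punchOutAll a xs a≢xs
  q-length : length q ≡ n
  q-length = trans (sym (length-map (punchIn a) q)) (trans (cong length map-q≡xs) (ℕ.suc-injective len))

perms∼permsByFirst : ∀ n → perms n ∼[ set ] permsByFirst n
perms∼permsByFirst n = mk⇔ to from
  where
  to : ∀ {p} → p ∈ perms n → p ∈ permsByFirst n
  to p∈ with ∈-filter⁻ (UniqueDec.unique? Fin._≟_) {xs = words n n} p∈
  ... | p∈words , p! = ∈-permsByFirst⁺ n _ (∈-words⁻ n n p∈words) p!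
  from : ∀ {p} → p ∈ permsByFirst n → p ∈ perms n
  from {p} p∈ = ∈-filter⁺ (UniqueDec.unique? Fin._≟_)
    (subst (λ k → p ∈ words n k) (permsByFirst-length n p∈) (∈-words⁺ n p)) (permsByFirst-distinct n p∈)

perms↭permsByFirst : ∀ n → perms n ↭ permsByFirst n
perms↭permsByFirst n = ∼bag⇒↭ (unique∧set⇒bag (Unique.filter⁺ _ (words-unique n n)) (permsByFirst-unique n)
                                               (perms∼permsByFirst n))

permsByFirst↭allFin : ∀ n {p} → p ∈ permsByFirst n → p ↭ allFin n
permsByFirst↭allFin n p∈ = ∼bag⇒↭ (unique∧set⇒bag (permsByFirst-distinct n p∈) (Unique.allFin⁺ n)
  (λ {x} → mk⇔ (λ _ → ∈-allFin x) (λ _ → permsByFirst-complete n p∈ x)))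

v≡countᵇ-permsByFirst : ∀ r n → v r n ≡ countᵇ (λ p → occ231 p ≡ᵇ r) (permsByFirst n)
v≡countᵇ-permsByFirst r n =
  trans (↭-length (filter-↭ (λ p → occ231 p ℕ.≟ r) (perms↭permsByFirst n))) (length-filter _ (permsByFirst n))

punchIn-<-⇔ : (a : Fin (suc n)) (x y : Fin n) → x Fin.< y ⇔ punchIn a x Fin.< punchIn a y
punchIn-<-⇔ a x y = mk⇔ (λ x<y → ℕ.≰⇒> (ℕ.<⇒≱ x<y ∘ Fin.punchIn-cancel-≤ a y x))
                        (λ x<y → ℕ.≰⇒> (ℕ.<⇒≱ x<y ∘ Fin.punchIn-mono-≤ a y x))

does-punchIn-<? : (a : Fin (suc n)) (x y : Fin n) → does (punchIn a x Fin.<? punchIn a y) ≡ does (x Fin.<? y)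
does-punchIn-<? a x y = sym (does-⇔ (punchIn-<-⇔ a x y) (x Fin.<? y) (punchIn a x Fin.<? punchIn a y))

countBelow-map-punchIn : (a : Fin (suc n)) (x : Fin n) (zs : List (Fin n)) →
                         countBelow (punchIn a x) (map (punchIn a) zs) ≡ countBelow x zs
countBelow-map-punchIn a x []       = refl
countBelow-map-punchIn a x (z ∷ zs) =
  cong₂ (λ b k → (if b then 1 else 0) + k) (does-punchIn-<? a z x) (countBelow-map-punchIn a x zs)

occ231-map-punchIn : (a : Fin (suc n)) (w : List (Fin n)) → occ231 (map (punchIn a) w) ≡ occ231 w
occ231-map-punchIn a []             = refl
occ231-map-punchIn a (x ∷ [])       = refl
occ231-map-punchIn a (x ∷ y ∷ rest) =
  cong₂ _+_ (cong₂ (λ b k → if b then k else 0) (does-punchIn-<? a x y) (countBelow-map-punchIn a x rest))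
            (occ231-map-punchIn a (y ∷ rest))

countBelow≡countᵇ : (x : Fin n) (zs : List (Fin n)) → countBelow x zs ≡ countᵇ (λ z → does (z Fin.<? x)) zs
countBelow≡countᵇ x []       = refl
countBelow≡countᵇ x (z ∷ zs) = cong (_+_ _) (countBelow≡countᵇ x zs)

countBelow-zero : (zs : List (Fin (suc n))) → countBelow zero zs ≡ 0
countBelow-zero []       = refl
countBelow-zero (z ∷ zs) = countBelow-zero zs

countBelow-allFin : (x : Fin n) → countBelow x (allFin n) ≡ toℕ x
countBelow-allFin {suc n} zero    = countBelow-zero (allFin (suc n))
countBelow-allFin {suc n} (suc x) = cong suc (begin
  countBelow (suc x) (tabulate suc)         ≡⟨ cong (countBelow (suc x)) (map-tabulate (λ i → i) suc) ⟨
  countBelow (suc x) (map suc (allFin n))   ≡⟨ countBelow-map-punchIn zero x (allFin n) ⟩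
  countBelow x (allFin n)                   ≡⟨ countBelow-allFin x ⟩
  toℕ x                                     ∎)
  where open ≡-Reasoning

countBelow-permsByFirst : ∀ {p} → p ∈ permsByFirst n → (x : Fin n) → countBelow x p ≡ toℕ x
countBelow-permsByFirst {n} {p} p∈ x = begin
  countBelow x p                                 ≡⟨ countBelow≡countᵇ x p ⟩
  countᵇ (λ z → does (z Fin.<? x)) p             ≡⟨ countᵇ-↭ _ (permsByFirst↭allFin n p∈) ⟩
  countᵇ (λ z → does (z Fin.<? x)) (allFin n)    ≡⟨ countBelow≡countᵇ x (allFin n) ⟨
  countBelow x (allFin n)                        ≡⟨ countBelow-allFin x ⟩
  toℕ x                                          ∎
  where open ≡-Reasoning

occ231-zero◃ : (q : List (Fin n)) → occ231 (zero ◃ q) ≡ occ231 q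
occ231-zero◃ []         = refl
occ231-zero◃ (y ∷ rest) = cong₂ _+_ (countBelow-zero (map suc rest)) (occ231-map-punchIn zero (y ∷ rest))

ascentWeight : ℕ → ℕ → ℕ
ascentWeight a b = if a ≤ᵇ b then a else 0

<-punchIn⇔≤ : (a : Fin (suc n)) (b : Fin n) → a Fin.< punchIn a b ⇔ toℕ a ≤ toℕ b
<-punchIn⇔≤ zero    b       = mk⇔ (λ _ → z≤n) (λ _ → s≤s z≤n)
<-punchIn⇔≤ (suc a) zero    = mk⇔ (λ ()) (λ ())
<-punchIn⇔≤ (suc a) (suc b) = mk⇔ (λ { (s≤s a<b′) → s≤s (to a<b′) }) (λ { (s≤s a≤b) → s≤s (from a≤b) })
  where open Equivalence (<-punchIn⇔≤ a b)

occ231-◃-◃ : (a : Fin (suc (suc n))) (b : Fin (suc n)) {q : List (Fin n)} → q ∈ permsByFirst n →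
             occ231 (a ◃ b ◃ q) ≡ ascentWeight (toℕ a) (toℕ b) + occ231 (b ◃ q)
occ231-◃-◃ a b {q} q∈ = cong₂ _+_ firstPair (occ231-map-punchIn a (b ◃ q))
  where
  rest = map (punchIn a) (map (punchIn b) q)

  rest-below : toℕ a ≤ toℕ b → countBelow a rest ≡ toℕ a
  rest-below a≤b = begin
    countBelow a rest
      ≡⟨ cong₂ (λ x y → (if x then 1 else 0) + ((if y then 1 else 0) + countBelow a rest)) a≮a b′≮a ⟨
    countBelow a (a ◃ b ◃ q)
      ≡⟨ countBelow-permsByFirst (◃-∈-permsByFirst a (◃-∈-permsByFirst b q∈)) a ⟩
    toℕ a
      ∎
    where
    open ≡-Reasoning
    a≮a : does (a Fin.<? a) ≡ false
    a≮a = dec-false (a Fin.<? a) (ℕ.n≮n _)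
    b′≮a : does (punchIn a b Fin.<? a) ≡ false
    b′≮a = dec-false (punchIn a b Fin.<? a) (ℕ.<-asym (Equivalence.from (<-punchIn⇔≤ a b) a≤b))

  firstPair : (if does (a Fin.<? punchIn a b) then countBelow a rest else 0) ≡ ascentWeight (toℕ a) (toℕ b)
  firstPair rewrite does-⇔ (<-punchIn⇔≤ a b) (a Fin.<? punchIn a b) (toℕ a ℕ.≤? toℕ b)
    with toℕ a ≤ᵇ toℕ b | ℕ.≤ᵇ-reflects-≤ (toℕ a) (toℕ b)
  ... | true  | ofʸ a≤b = rest-below a≤b
  ... | false | _       = refl

∑< : ℕ → (ℕ → ℕ) → ℕ
∑< zero    f = 0
∑< (suc n) f = f 0 + ∑< n (f ∘ suc)

sum-tabulate : ∀ n (f : ℕ → ℕ) → sum (tabulate {n = n} (f ∘ toℕ)) ≡ ∑< n f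
sum-tabulate zero    f = refl
sum-tabulate (suc n) f = cong (_+_ (f 0)) (sum-tabulate n (f ∘ suc))

sum-map-allFin : (f : ℕ → ℕ) → sum (map (f ∘ toℕ) (allFin n)) ≡ ∑< n f
sum-map-allFin {n} f = trans (cong sum (map-tabulate {n = n} (λ i → i) (f ∘ toℕ))) (sum-tabulate n f)

∑<-cong : ∀ n {f g : ℕ → ℕ} → (∀ i → f i ≡ g i) → ∑< n f ≡ ∑< n g
∑<-cong zero    f≗g = refl
∑<-cong (suc n) f≗g = cong₂ _+_ (f≗g 0) (∑<-cong n (f≗g ∘ suc))

∑<-suc : ∀ n (f : ℕ → ℕ) → ∑< (suc n) f ≡ ∑< n f + f n
∑<-suc zero    f = ℕ.+-comm (f 0) 0
∑<-suc (suc n) f = trans (cong (_+_ (f 0)) (∑<-suc n (f ∘ suc))) (sym (ℕ.+-assoc (f 0) _ _))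

∑<-+ : ∀ n (f g : ℕ → ℕ) → ∑< n (λ i → f i + g i) ≡ ∑< n f + ∑< n g
∑<-+ zero    f g = refl
∑<-+ (suc n) f g = trans (cong (_+_ (f 0 + g 0)) (∑<-+ n (f ∘ suc) (g ∘ suc))) (interchange (f 0) (g 0) _ _)

∑<-zeros : ∀ n → ∑< n (λ _ → 0) ≡ 0
∑<-zeros zero    = refl
∑<-zeros (suc n) = ∑<-zeros n

suc-≤ᵇ-suc : ∀ m n → (suc m ≤ᵇ suc n) ≡ (m ≤ᵇ n)
suc-≤ᵇ-suc zero    n = refl
suc-≤ᵇ-suc (suc m) n = refl

∑<-truncate : ∀ {c n} (f : ℕ → ℕ) → c ≤ n → ∑< n (λ b → if c ≤ᵇ b then 0 else f b) ≡ ∑< c f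
∑<-truncate {zero}  {n}     f _         = ∑<-zeros n
∑<-truncate {suc c} {suc n} f (s≤s c≤n) = cong (_+_ (f 0)) (trans
  (∑<-cong n (λ b → cong (λ t → if t then 0 else f (suc b)) (suc-≤ᵇ-suc c b)))
  (∑<-truncate (f ∘ suc) c≤n))

binomialTransform : (ℕ → ℕ) → ℕ → ℕ
binomialTransform f n = ∑< (suc n) λ i → (n C i) * f i

binomialTransform-cong : ∀ {f g : ℕ → ℕ} n → (∀ i → f i ≡ g i) → binomialTransform f n ≡ binomialTransform g n
binomialTransform-cong n f≗g = ∑<-cong (suc n) (λ i → cong ((n C i) *_) (f≗g i))

binomialTransform-+ : ∀ (f g : ℕ → ℕ) n →
                      binomialTransform (λ i → f i + g i) n ≡ binomialTransform f n + binomialTransform g n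
binomialTransform-+ f g n =
  trans (∑<-cong (suc n) (λ i → ℕ.*-distribˡ-+ (n C i) (f i) (g i)))
        (∑<-+ (suc n) (λ i → (n C i) * f i) (λ i → (n C i) * g i))

binomialTransform-suc : ∀ (f : ℕ → ℕ) n →
                        binomialTransform f (suc n) ≡ binomialTransform f n + binomialTransform (f ∘ suc) n
binomialTransform-suc f n = begin
  f 0 + 0 + ∑< (suc n) (λ i → (suc n C suc i) * f (suc i))
    ≡⟨ cong (_+_ (f 0 + 0)) (∑<-cong (suc n) λ i → cong (_* f (suc i)) (sym (nCk+nC[k+1]≡[n+1]C[k+1] n i))) ⟩
  f 0 + 0 + ∑< (suc n) (λ i → (n C i + n C suc i) * f (suc i))
    ≡⟨ cong (_+_ (f 0 + 0)) (trans (∑<-cong (suc n) λ i → ℕ.*-distribʳ-+ (f (suc i)) (n C i) (n C suc i))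
                                   (∑<-+ (suc n) (λ i → (n C i) * f (suc i)) upper)) ⟩
  f 0 + 0 + (binomialTransform (f ∘ suc) n + ∑< (suc n) upper)
    ≡⟨ cong (λ s → f 0 + 0 + (binomialTransform (f ∘ suc) n + s)) (∑<-suc n upper) ⟩
  f 0 + 0 + (binomialTransform (f ∘ suc) n + (∑< n upper + (n C suc n) * f (suc n)))
    ≡⟨ cong (λ t → f 0 + 0 + (binomialTransform (f ∘ suc) n + (∑< n upper + t * f (suc n))))
            (k>n⇒nCk≡0 (ℕ.n<1+n n)) ⟩
  f 0 + 0 + (binomialTransform (f ∘ suc) n + (∑< n upper + 0))
    ≡⟨ cong (λ s → f 0 + 0 + (binomialTransform (f ∘ suc) n + s)) (ℕ.+-identityʳ _) ⟩
  f 0 + 0 + (binomialTransform (f ∘ suc) n + ∑< n upper)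
    ≡⟨ cong (_+_ (f 0 + 0)) (ℕ.+-comm (binomialTransform (f ∘ suc) n) _) ⟩
  f 0 + 0 + (∑< n upper + binomialTransform (f ∘ suc) n)
    ≡⟨ ℕ.+-assoc (f 0 + 0) _ _ ⟨
  binomialTransform f n + binomialTransform (f ∘ suc) n
    ∎
  where
  open ≡-Reasoning
  upper : ℕ → ℕ
  upper i = (n C suc i) * f (suc i)

pascal⇒binomialTransform : (T : ℕ → ℕ → ℕ) → (∀ M c → c ≤ M → T (suc M) (suc c) ≡ T (suc M) c + T M c) →
                           ∀ d a → T (d + a) a ≡ binomialTransform (λ i → T (d + i) 0) a
pascal⇒binomialTransform T pascal d zero    = sym (trans (ℕ.+-identityʳ _) (ℕ.+-identityʳ _))
pascal⇒binomialTransform T pascal d (suc a) = begin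
  T (d + suc a) (suc a)
    ≡⟨ cong (λ M → T M (suc a)) (ℕ.+-suc d a) ⟩
  T (suc (d + a)) (suc a)
    ≡⟨ pascal (d + a) a (ℕ.m≤n+m a d) ⟩
  T (suc d + a) a + T (d + a) a
    ≡⟨ cong₂ _+_ (pascal⇒binomialTransform T pascal (suc d) a) (pascal⇒binomialTransform T pascal d a) ⟩
  binomialTransform (λ i → T (suc d + i) 0) a + binomialTransform f a
    ≡⟨ ℕ.+-comm _ (binomialTransform f a) ⟩
  binomialTransform f a + binomialTransform (λ i → T (suc d + i) 0) a
    ≡⟨ cong (_+_ (binomialTransform f a)) (binomialTransform-cong a λ i → cong (λ M → T M 0) (sym (ℕ.+-suc d i))) ⟩
  binomialTransform f a + binomialTransform (f ∘ suc) a
    ≡⟨ binomialTransform-suc f a ⟨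
  binomialTransform f (suc a)
    ∎
  where
  open ≡-Reasoning
  f : ℕ → ℕ
  f i = T (d + i) 0

countᵇ-+≡ᵇ0 : (e : ℕ) (f : A → ℕ) (xs : List A) →
              countᵇ (λ x → e + f x ≡ᵇ 0) xs ≡ (if e ≡ᵇ 0 then countᵇ (λ x → f x ≡ᵇ 0) xs else 0)
countᵇ-+≡ᵇ0 zero    f xs = refl
countᵇ-+≡ᵇ0 (suc e) f xs = countᵇ-false xs

countᵇ-+≡ᵇ1 : (e : ℕ) (f : A → ℕ) (xs : List A) →
              countᵇ (λ x → e + f x ≡ᵇ 1) xs ≡
              (if e ≡ᵇ 0 then countᵇ (λ x → f x ≡ᵇ 1) xs else 0)
              + (if e ≡ᵇ 1 then countᵇ (λ x → f x ≡ᵇ 0) xs else 0)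
countᵇ-+≡ᵇ1 zero          f xs = sym (ℕ.+-identityʳ _)
countᵇ-+≡ᵇ1 (suc zero)    f xs = refl
countᵇ-+≡ᵇ1 (suc (suc e)) f xs = countᵇ-false xs

countᵇ-◃-permsByFirst : (a : Fin (suc (suc m))) (P : ℕ → Bool) →
  countᵇ (λ q → P (occ231 (a ◃ q))) (permsByFirst (suc m)) ≡
  sum (map (λ b → countᵇ (λ q → P (ascentWeight (toℕ a) (toℕ b) + occ231 (b ◃ q))) (permsByFirst m))
           (allFin (suc m)))
countᵇ-◃-permsByFirst {m} a P =
  trans (countᵇ-concatMap _ (λ b → map (b ◃_) (permsByFirst m)) (allFin (suc m)))
        (cong sum (map-cong (λ b → trans (countᵇ-map _ (b ◃_) (permsByFirst m))
                                         (countᵇ-cong (permsByFirst m) (cong P ∘ occ231-◃-◃ a b)))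
                            (allFin (suc m))))

-- v₀-from m a and v₁-from m a count the permutations a ◃ q of [m+1] with no, respectively one,
-- occurrence of 23-1; the sums run over the second letter.
v₀-from : ℕ → ℕ → ℕ
v₀-from zero    a = 1
v₀-from (suc m) a = ∑< (suc m) λ b → if ascentWeight a b ≡ᵇ 0 then v₀-from m b else 0

v₁-from : ℕ → ℕ → ℕ
v₁-from zero    a = 0
v₁-from (suc m) a = ∑< (suc m) λ b → (if ascentWeight a b ≡ᵇ 0 then v₁-from m b else 0)
                                   + (if ascentWeight a b ≡ᵇ 1 then v₀-from m b else 0)

countᵇ-occ231-◃≡0 : (a : Fin (suc m)) →
                    countᵇ (λ q → occ231 (a ◃ q) ≡ᵇ 0) (permsByFirst m) ≡ v₀-from m (toℕ a)
countᵇ-occ231-◃≡0 {zero}  a = refl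
countᵇ-occ231-◃≡0 {suc m} a = begin
  countᵇ (λ q → occ231 (a ◃ q) ≡ᵇ 0) (permsByFirst (suc m))
    ≡⟨ countᵇ-◃-permsByFirst a (_≡ᵇ 0) ⟩
  sum (map (λ b → countᵇ (λ q → weight b + occ231 (b ◃ q) ≡ᵇ 0) (permsByFirst m)) (allFin (suc m)))
    ≡⟨ cong sum (map-cong (λ b → trans (countᵇ-+≡ᵇ0 (weight b) _ (permsByFirst m))
                                       (cong (λ k → if weight b ≡ᵇ 0 then k else 0) (countᵇ-occ231-◃≡0 b)))
                          (allFin (suc m))) ⟩
  sum (map (term ∘ toℕ) (allFin (suc m)))
    ≡⟨ sum-map-allFin {suc m} term ⟩
  v₀-from (suc m) (toℕ a)
    ∎
  where
  open ≡-Reasoning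
  weight : Fin (suc m) → ℕ
  weight b = ascentWeight (toℕ a) (toℕ b)
  term : ℕ → ℕ
  term b = if ascentWeight (toℕ a) b ≡ᵇ 0 then v₀-from m b else 0

countᵇ-occ231-◃≡1 : (a : Fin (suc m)) →
                    countᵇ (λ q → occ231 (a ◃ q) ≡ᵇ 1) (permsByFirst m) ≡ v₁-from m (toℕ a)
countᵇ-occ231-◃≡1 {zero}  a = refl
countᵇ-occ231-◃≡1 {suc m} a = begin
  countᵇ (λ q → occ231 (a ◃ q) ≡ᵇ 1) (permsByFirst (suc m))
    ≡⟨ countᵇ-◃-permsByFirst a (_≡ᵇ 1) ⟩
  sum (map (λ b → countᵇ (λ q → weight b + occ231 (b ◃ q) ≡ᵇ 1) (permsByFirst m)) (allFin (suc m)))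
    ≡⟨ cong sum (map-cong (λ b → trans (countᵇ-+≡ᵇ1 (weight b) _ (permsByFirst m))
                                       (cong₂ (λ k l → (if weight b ≡ᵇ 0 then k else 0) + (if weight b ≡ᵇ 1 then l else 0))
                                              (countᵇ-occ231-◃≡1 b) (countᵇ-occ231-◃≡0 b)))
                          (allFin (suc m))) ⟩
  sum (map (term ∘ toℕ) (allFin (suc m)))
    ≡⟨ sum-map-allFin {suc m} term ⟩
  v₁-from (suc m) (toℕ a)
    ∎
  where
  open ≡-Reasoning
  weight : Fin (suc m) → ℕ
  weight b = ascentWeight (toℕ a) (toℕ b)
  term : ℕ → ℕ
  term b = (if ascentWeight (toℕ a) b ≡ᵇ 0 then v₁-from m b else 0)
         + (if ascentWeight (toℕ a) b ≡ᵇ 1 then v₀-from m b else 0)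

v≡countᵇ-zero◃ : ∀ r m → v r m ≡ countᵇ (λ q → occ231 (zero ◃ q) ≡ᵇ r) (permsByFirst m)
v≡countᵇ-zero◃ r m =
  trans (v≡countᵇ-permsByFirst r m) (countᵇ-cong (permsByFirst m) (λ {q} _ → cong (_≡ᵇ r) (sym (occ231-zero◃ q))))

v₀≡v₀-from : ∀ m → v 0 m ≡ v₀-from m 0
v₀≡v₀-from m = trans (v≡countᵇ-zero◃ 0 m) (countᵇ-occ231-◃≡0 {m} zero)

v₁≡v₁-from : ∀ m → v 1 m ≡ v₁-from m 0
v₁≡v₁-from m = trans (v≡countᵇ-zero◃ 1 m) (countᵇ-occ231-◃≡1 {m} zero)

v₀-from-prefix : ∀ M c → c ≤ M → v₀-from (suc M) (suc c) ≡ ∑< (suc c) (v₀-from M)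
v₀-from-prefix M c c≤M =
  trans (∑<-cong (suc M) λ b → descent (suc c ≤ᵇ b) (v₀-from M b)) (∑<-truncate (v₀-from M) (s≤s c≤M))
  where
  descent : ∀ t k → (if (if t then suc c else 0) ≡ᵇ 0 then k else 0) ≡ (if t then 0 else k)
  descent true  k = refl
  descent false k = refl

v₁-from-prefix : ∀ M c → suc c ≤ M → v₁-from (suc M) (suc (suc c)) ≡ ∑< (suc (suc c)) (v₁-from M)
v₁-from-prefix M c c<M =
  trans (∑<-cong (suc M) λ b → descent (suc (suc c) ≤ᵇ b) (v₁-from M b) (v₀-from M b))
        (∑<-truncate (v₁-from M) (s≤s c<M))
  where
  descent : ∀ t k l → (if (if t then suc (suc c) else 0) ≡ᵇ 0 then k else 0)
                      + (if (if t then suc (suc c) else 0) ≡ᵇ 1 then l else 0) ≡ (if t then 0 else k)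
  descent true  k l = refl
  descent false k l = ℕ.+-identityʳ k

v₀-pascal : ∀ M c → c ≤ M →
            v₀-from (2 + M) (2 + c) ≡ v₀-from (2 + M) (1 + c) + v₀-from (1 + M) (1 + c)
v₀-pascal M c c≤M = begin
  v₀-from (2 + M) (2 + c)
    ≡⟨ v₀-from-prefix (1 + M) (1 + c) (s≤s c≤M) ⟩
  ∑< (2 + c) (v₀-from (1 + M))
    ≡⟨ ∑<-suc (1 + c) (v₀-from (1 + M)) ⟩
  ∑< (1 + c) (v₀-from (1 + M)) + v₀-from (1 + M) (1 + c)
    ≡⟨ cong (_+ v₀-from (1 + M) (1 + c)) (v₀-from-prefix (1 + M) c (ℕ.m≤n⇒m≤1+n c≤M)) ⟨
  v₀-from (2 + M) (1 + c) + v₀-from (1 + M) (1 + c)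
    ∎
  where open ≡-Reasoning

v₁-pascal : ∀ M c → c ≤ M →
            v₁-from (3 + M) (3 + c) ≡ v₁-from (3 + M) (2 + c) + v₁-from (2 + M) (2 + c)
v₁-pascal M c c≤M = begin
  v₁-from (3 + M) (3 + c)
    ≡⟨ v₁-from-prefix (2 + M) (1 + c) (s≤s (s≤s c≤M)) ⟩
  ∑< (3 + c) (v₁-from (2 + M))
    ≡⟨ ∑<-suc (2 + c) (v₁-from (2 + M)) ⟩
  ∑< (2 + c) (v₁-from (2 + M)) + v₁-from (2 + M) (2 + c)
    ≡⟨ cong (_+ v₁-from (2 + M) (2 + c)) (v₁-from-prefix (2 + M) c (s≤s (ℕ.m≤n⇒m≤1+n c≤M))) ⟨
  v₁-from (3 + M) (2 + c) + v₁-from (2 + M) (2 + c)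
    ∎
  where open ≡-Reasoning

v₀-suc : ∀ m → v 0 (suc m) ≡ binomialTransform (v 0) m
v₀-suc m = begin
  v 0 (suc m)
    ≡⟨ v₀≡v₀-from (suc m) ⟩
  ∑< (suc m) (v₀-from m)
    ≡⟨ v₀-from-prefix m m ℕ.≤-refl ⟨
  v₀-from (suc m) (suc m)
    ≡⟨ pascal⇒binomialTransform (λ M c → v₀-from (1 + M) (1 + c)) v₀-pascal 0 m ⟩
  binomialTransform (λ i → v₀-from (suc i) 1) m
    ≡⟨ binomialTransform-cong m column ⟩
  binomialTransform (v 0) m
    ∎
  where
  open ≡-Reasoning
  column : ∀ i → v₀-from (suc i) 1 ≡ v 0 i
  column i = trans (v₀-from-prefix i 0 z≤n) (trans (ℕ.+-identityʳ _) (sym (v₀≡v₀-from i)))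

-- After 1, the second letter 0 adds no occurrence and any larger second letter adds exactly one,
-- so v₁-from (suc i) 1 unfolds to v₁-from i 0 + 0 + ∑< i (v₀-from i ∘ suc).
v₁-from-1 : ∀ i → v₁-from (suc i) 1 + v 0 i ≡ v 1 i + v 0 (suc i)
v₁-from-1 i rewrite v₀≡v₀-from i | v₀≡v₀-from (suc i) | v₁≡v₁-from i =
  rearrange (v₁-from i 0) (v₀-from i 0) (∑< i (v₀-from i ∘ suc))
  where
  rearrange : ∀ x y s → x + 0 + s + y ≡ x + (y + s)
  rearrange = ℕ-solve-∀

v₁-column : ∀ i → v₁-from (suc (suc i)) 2 + v 0 i ≡ v 1 (suc i) + (v 1 i + v 0 (suc i))
v₁-column i = begin
  v₁-from (2 + i) 2 + v 0 i                               ≡⟨ cong (_+ v 0 i) (v₁-from-prefix (1 + i) 0 (s≤s z≤n)) ⟩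
  v₁-from (1 + i) 0 + (v₁-from (1 + i) 1 + 0) + v 0 i     ≡⟨ cong (λ k → v₁-from (1 + i) 0 + k + v 0 i) (ℕ.+-identityʳ _) ⟩
  v₁-from (1 + i) 0 + v₁-from (1 + i) 1 + v 0 i           ≡⟨ ℕ.+-assoc (v₁-from (1 + i) 0) _ _ ⟩
  v₁-from (1 + i) 0 + (v₁-from (1 + i) 1 + v 0 i)         ≡⟨ cong₂ _+_ (sym (v₁≡v₁-from (suc i))) (v₁-from-1 i) ⟩
  v 1 (suc i) + (v 1 i + v 0 (suc i))                     ∎
  where open ≡-Reasoning

v₁-suc-suc : ∀ m → v 1 (suc (suc m)) + v 0 (suc m) ≡ binomialTransform (v 1) (suc m) + binomialTransform (v 0 ∘ suc) m
v₁-suc-suc m = begin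
  v 1 (2 + m) + v 0 (1 + m)
    ≡⟨ cong₂ _+_ v₁-total (v₀-suc m) ⟩
  binomialTransform column m + binomialTransform (v 0) m
    ≡⟨ binomialTransform-+ column (v 0) m ⟨
  binomialTransform (λ i → column i + v 0 i) m
    ≡⟨ binomialTransform-cong m v₁-column ⟩
  binomialTransform (λ i → v 1 (suc i) + (v 1 i + v 0 (suc i))) m
    ≡⟨ trans (binomialTransform-+ (v 1 ∘ suc) (λ i → v 1 i + v 0 (suc i)) m)
             (cong (_+_ (binomialTransform (v 1 ∘ suc) m)) (binomialTransform-+ (v 1) (v 0 ∘ suc) m)) ⟩
  binomialTransform (v 1 ∘ suc) m + (binomialTransform (v 1) m + binomialTransform (v 0 ∘ suc) m)
    ≡⟨ rearrange (binomialTransform (v 1 ∘ suc) m) (binomialTransform (v 1) m) (binomialTransform (v 0 ∘ suc) m) ⟩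
  binomialTransform (v 1) m + binomialTransform (v 1 ∘ suc) m + binomialTransform (v 0 ∘ suc) m
    ≡⟨ cong (_+ binomialTransform (v 0 ∘ suc) m) (binomialTransform-suc (v 1) m) ⟨
  binomialTransform (v 1) (suc m) + binomialTransform (v 0 ∘ suc) m
    ∎
  where
  open ≡-Reasoning
  column : ℕ → ℕ
  column i = v₁-from (suc (suc i)) 2
  rearrange : ∀ x y z → x + (y + z) ≡ y + x + z
  rearrange = ℕ-solve-∀
  v₁-total : v 1 (suc (suc m)) ≡ binomialTransform column m
  v₁-total = begin
    v 1 (2 + m)                          ≡⟨ v₁≡v₁-from (2 + m) ⟩
    v₁-from (2 + m) 0                    ≡⟨ ∑<-cong (2 + m) (λ b → ℕ.+-identityʳ (v₁-from (1 + m) b)) ⟩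
    ∑< (2 + m) (v₁-from (1 + m))         ≡⟨ v₁-from-prefix (1 + m) m ℕ.≤-refl ⟨
    v₁-from (2 + m) (2 + m)              ≡⟨ pascal⇒binomialTransform (λ M c → v₁-from (2 + M) (2 + c)) v₁-pascal 0 m ⟩
    binomialTransform column m           ∎

sumTo-cong : ∀ n {f g : ℕ → ℤ} → (∀ i → f i ≡ g i) → sumTo f n ≡ sumTo g n
sumTo-cong zero    f≗g = f≗g 0
sumTo-cong (suc n) f≗g = cong₂ ℤ._+_ (sumTo-cong n f≗g) (f≗g (suc n))

sumTo-suc : ∀ n (f : ℕ → ℤ) → sumTo f (suc n) ≡ f 0 ℤ.+ sumTo (f ∘ suc) n
sumTo-suc zero    f = refl
sumTo-suc (suc n) f = trans (cong (ℤ._+ f (suc (suc n))) (sumTo-suc n f)) (ℤ.+-assoc (f 0) _ _)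

sumTo-reverse : ∀ n (f : ℕ → ℤ) → sumTo (λ j → f (n ∸ j)) n ≡ sumTo f n
sumTo-reverse zero    f = refl
sumTo-reverse (suc n) f = begin
  sumTo (λ j → f (suc n ∸ j)) (suc n)          ≡⟨ sumTo-suc n (λ j → f (suc n ∸ j)) ⟩
  f (suc n) ℤ.+ sumTo (λ j → f (n ∸ j)) n      ≡⟨ cong (ℤ._+_ (f (suc n))) (sumTo-reverse n f) ⟩
  f (suc n) ℤ.+ sumTo f n                      ≡⟨ ℤ.+-comm (f (suc n)) (sumTo f n) ⟩
  sumTo f (suc n)                              ∎
  where open ≡-Reasoning

sumTo-zeros : ∀ n → sumTo (λ _ → + 0) n ≡ + 0
sumTo-zeros zero    = refl
sumTo-zeros (suc n) = cong (ℤ._+ + 0) (sumTo-zeros n)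

sumTo-+ : ∀ n (g : ℕ → ℕ) → sumTo (λ i → + g i) n ≡ + ∑< (suc n) g
sumTo-+ zero    g = cong +_ (sym (ℕ.+-identityʳ (g 0)))
sumTo-+ (suc n) g = trans (cong (ℤ._+ + g (suc n)) (sumTo-+ n g)) (cong +_ (sym (∑<-suc (suc n) g)))

xOver1-x-⊛-suc : ∀ (F : Series) k → (xOver1-x ⊛ F) (suc k) ≡ sumTo F k
xOver1-x-⊛-suc F k = begin
  sumTo (λ j → xOver1-x j ℤ.* F (suc k ∸ j)) (suc k)   ≡⟨ sumTo-suc k (λ j → xOver1-x j ℤ.* F (suc k ∸ j)) ⟩
  + 0 ℤ.+ sumTo (λ j → + 1 ℤ.* F (k ∸ j)) k            ≡⟨ ℤ.+-identityˡ _ ⟩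
  sumTo (λ j → + 1 ℤ.* F (k ∸ j)) k                    ≡⟨ sumTo-cong k (λ j → ℤ.*-identityˡ (F (k ∸ j))) ⟩
  sumTo (λ j → F (k ∸ j)) k                            ≡⟨ sumTo-reverse k F ⟩
  sumTo F k                                            ∎
  where open ≡-Reasoning

X-⊛-suc : ∀ (F : Series) k → (X ⊛ F) (suc k) ≡ F k
X-⊛-suc F zero    = trans (ℤ.+-identityˡ _) (ℤ.*-identityˡ (F 0))
X-⊛-suc F (suc k) = begin
  sumTo (λ j → X j ℤ.* F (2 + k ∸ j)) (2 + k)          ≡⟨ sumTo-suc (suc k) (λ j → X j ℤ.* F (2 + k ∸ j)) ⟩
  + 0 ℤ.+ sumTo (λ j → X (suc j) ℤ.* F (suc k ∸ j)) (suc k)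
                                                        ≡⟨ ℤ.+-identityˡ _ ⟩
  sumTo (λ j → X (suc j) ℤ.* F (suc k ∸ j)) (suc k)    ≡⟨ sumTo-suc k (λ j → X (suc j) ℤ.* F (suc k ∸ j)) ⟩
  + 1 ℤ.* F (suc k) ℤ.+ sumTo (λ _ → + 0) k            ≡⟨ cong₂ ℤ._+_ (ℤ.*-identityˡ (F (suc k))) (sumTo-zeros k) ⟩
  F (suc k) ℤ.+ + 0                                     ≡⟨ ℤ.+-identityʳ (F (suc k)) ⟩
  F (suc k)                                             ∎
  where open ≡-Reasoning

pow-xOver1-x : ∀ m n → pow xOver1-x (suc m) (suc n) ≡ + (n C m)
pow-xOver1-x zero    zero    = refl
pow-xOver1-x (suc m) zero    = refl
pow-xOver1-x m       (suc n) = begin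
  pow xOver1-x (suc m) (2 + n)                   ≡⟨ xOver1-x-⊛-suc (pow xOver1-x m) (suc n) ⟩
  sumTo (pow xOver1-x m) n ℤ.+ last              ≡⟨ cong (ℤ._+ last) (xOver1-x-⊛-suc (pow xOver1-x m) n) ⟨
  pow xOver1-x (suc m) (suc n) ℤ.+ last          ≡⟨ cong (ℤ._+ last) (pow-xOver1-x m n) ⟩
  + (n C m) ℤ.+ last                             ≡⟨ pascal m ⟩
  + (suc n C m)                                  ∎
  where
  open ≡-Reasoning
  last : ℤ
  last = pow xOver1-x m (suc n)
  pascal : ∀ m → + (n C m) ℤ.+ pow xOver1-x m (suc n) ≡ + (suc n C m)
  pascal zero    = ℤ.+-identityʳ _
  pascal (suc m) = trans (cong (ℤ._+_ (+ (n C suc m))) (pow-xOver1-x m n))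
                         (cong +_ (trans (ℕ.+-comm (n C suc m) (n C m)) (nCk+nC[k+1]≡[n+1]C[k+1] n m)))

∘ₛ-xOver1-x-suc : ∀ (g : ℕ → ℕ) k → ((+_ ∘ g) ∘ₛ xOver1-x) (suc k) ≡ + binomialTransform (g ∘ suc) k
∘ₛ-xOver1-x-suc g k = begin
  sumTo (λ m → + g m ℤ.* pow xOver1-x m (suc k)) (suc k)
    ≡⟨ sumTo-suc k (λ m → + g m ℤ.* pow xOver1-x m (suc k)) ⟩
  + g 0 ℤ.* + 0 ℤ.+ sumTo (λ m → + g (suc m) ℤ.* pow xOver1-x (suc m) (suc k)) k
    ≡⟨ cong (ℤ._+ sumTo (λ m → + g (suc m) ℤ.* pow xOver1-x (suc m) (suc k)) k) (ℤ.*-zeroʳ (+ g 0)) ⟩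
  + 0 ℤ.+ sumTo (λ m → + g (suc m) ℤ.* pow xOver1-x (suc m) (suc k)) k
    ≡⟨ ℤ.+-identityˡ _ ⟩
  sumTo (λ m → + g (suc m) ℤ.* pow xOver1-x (suc m) (suc k)) k
    ≡⟨ sumTo-cong k (λ m → trans (cong (ℤ._*_ (+ g (suc m))) (pow-xOver1-x m k))
                                 (trans (sym (ℤ.pos-* (g (suc m)) (k C m))) (cong +_ (ℕ.*-comm (g (suc m)) (k C m))))) ⟩
  sumTo (λ m → + ((k C m) * g (suc m))) k
    ≡⟨ sumTo-+ k (λ m → (k C m) * g (suc m)) ⟩
  + binomialTransform (g ∘ suc) k
    ∎
  where open ≡-Reasoning

sumTo-∘ₛ-xOver1-x : ∀ (g : ℕ → ℕ) k → sumTo ((+_ ∘ g) ∘ₛ xOver1-x) k ≡ + binomialTransform g k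
sumTo-∘ₛ-xOver1-x g zero    = trans (ℤ.*-identityʳ (+ g 0)) (cong +_ (sym (trans (ℕ.+-identityʳ _) (ℕ.+-identityʳ _))))
sumTo-∘ₛ-xOver1-x g (suc k) =
  trans (cong₂ ℤ._+_ (sumTo-∘ₛ-xOver1-x g k) (∘ₛ-xOver1-x-suc g k)) (cong +_ (sym (binomialTransform-suc g k)))

a+d≡b+c⇒+a≡+b+[+c-+d] : ∀ {a b c d} → a + d ≡ b + c → + a ≡ + b ℤ.+ (+ c ℤ.- + d)
a+d≡b+c⇒+a≡+b+[+c-+d] {a} {b} {c} {d} a+d≡b+c = begin
  + a                            ≡⟨ add-sub (+ a) (+ d) ⟩
  (+ a ℤ.+ + d) ℤ.- + d          ≡⟨ cong (λ z → + z ℤ.- + d) a+d≡b+c ⟩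
  (+ b ℤ.+ + c) ℤ.- + d          ≡⟨ sub-assoc (+ b) (+ c) (+ d) ⟩
  + b ℤ.+ (+ c ℤ.- + d)          ∎
  where
  open ≡-Reasoning
  add-sub : ∀ x y → x ≡ (x ℤ.+ y) ℤ.- y
  add-sub = solve-∀
  sub-assoc : ∀ x y z → (x ℤ.+ y) ℤ.- z ≡ x ℤ.+ (y ℤ.- z)
  sub-assoc = solve-∀

V₁-suc : ∀ k → V 1 (suc k) ≡ + binomialTransform (v 1) k ℤ.+ ((V 0 ∘ₛ xOver1-x) ⊖ V 0) k
V₁-suc zero    = refl
V₁-suc (suc m) =
  trans (a+d≡b+c⇒+a≡+b+[+c-+d] (v₁-suc-suc m))
        (cong (λ z → + binomialTransform (v 1) (suc m) ℤ.+ (z ℤ.- + v 0 (suc m))) (sym (∘ₛ-xOver1-x-suc (v 0) m)))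

corollary3 : ∀ (n : ℕ) → V 1 n ≡ ((xOver1-x ⊛ (V 1 ∘ₛ xOver1-x)) ⊕ (X ⊛ ((V 0 ∘ₛ xOver1-x) ⊖ V 0))) n
corollary3 zero    = refl
corollary3 (suc k) = begin
  V 1 (suc k)
    ≡⟨ V₁-suc k ⟩
  + binomialTransform (v 1) k ℤ.+ D k
    ≡⟨ cong₂ ℤ._+_ (sumTo-∘ₛ-xOver1-x (v 1) k) (X-⊛-suc D k) ⟨
  sumTo (V 1 ∘ₛ xOver1-x) k ℤ.+ (X ⊛ D) (suc k)
    ≡⟨ cong (ℤ._+ (X ⊛ D) (suc k)) (xOver1-x-⊛-suc (V 1 ∘ₛ xOver1-x) k) ⟨
  ((xOver1-x ⊛ (V 1 ∘ₛ xOver1-x)) ⊕ (X ⊛ D)) (suc k)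
    ∎
  where
  open ≡-Reasoning
  D : Series
  D = (V 0 ∘ₛ xOver1-x) ⊖ V 0
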